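{- Let $w$ be a finite word. For any two different primitive factors $u, v$ of $w$ with $m(u) \geq 3$ and $m(v) \geq 3$, we have $$\{u(i) : i \in \mathbb{Z},\ 2 \leq i \leq m(u)-1\} \cap \{v(i) : i\in\mathbb{Z},\ 2 \leq i \leq m(v)-1\} = \emptyset.$$
   Context: Words are finite sequences of letters; $u$ is a factor of $w$ if $w=pus$ for some words $p,s$. A non-empty word $u$ is primitive if $u = x^k$ (concatenation of $k$ copies of a word $x$, $k$ a positive integer) implies $k=1$. For a non-empty word $u$ and a positive rational number $r = a/|u|$ (with $a$ a positive integer), the rational power $u^{r}$ is defined as follows: write $a = c|u| + d$ with integers $c \ge 0$, $0 \le d < |u|$; then $u^{r} = u^c u'$, where $u'$ is the prefix of $u$ of length $d$. For a non-empty factor $u$ of $w$, $m(u) = \max\{r \in \mathbb{Q}^+ : u^r \text{ is a factor of } w\}$. For an integer $i$ with $1 \le i \le m(u)$, $u(i)$ denotes the shortest suffix of $u^{m(u)}$ that has $u^i$ as a prefix. -}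

module Defs where

open import Data.Nat using (ℕ; _+_; _*_; _<_; _≤_)
open import Data.List using (List; []; _++_; length; take; concat; replicate)
open import Data.Product using (Σ; ∃; _×_; _,_)
open import Relation.Binary.PropositionalEquality using (_≡_; _≢_)

module _ {A : Set} where

  Factor : List A → List A → Set
  Factor u w = Σ (List A) λ p → Σ (List A) λ s → w ≡ p ++ (u ++ s)

  Prefix : List A → List A → Set
  Prefix x z = Σ (List A) λ s → z ≡ x ++ s

  Suffix : List A → List A → Set
  Suffix z y = Σ (List A) λ p → y ≡ p ++ z

  rep : ℕ → List A → List A
  rep k u = concat (replicate k u)

  Primitive : List A → Set
  Primitive u = (u ≢ []) × (∀ (x : List A) (k : ℕ) → 1 ≤ k → u ≡ rep k x → k ≡ 1)

  -- RatPow u a z : z is the rational power u^(a/|u|)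
  -- (a = c|u| + d, 0 ≤ d < |u|, z = u^c u' with u' the prefix of u of length d)
  RatPow : List A → ℕ → List A → Set
  RatPow u a z = Σ ℕ λ c → Σ ℕ λ d →
    (a ≡ c * length u + d) × (d < length u) × (z ≡ rep c u ++ take d u)

  PowFactor : List A → List A → ℕ → Set
  PowFactor w u a = (1 ≤ a) × Σ (List A) λ z → RatPow u a z × Factor z w

  -- MaxExp w u a : m(u) = a/|u| (a is the numerator over |u| of the maximal exponent)
  MaxExp : List A → List A → ℕ → Set
  MaxExp w u a = PowFactor w u a × (∀ b → PowFactor w u b → b ≤ a)

  -- UAt u a i z : z = u(i), the shortest suffix of u^(a/|u|) having u^i as a prefix
  UAt : List A → ℕ → ℕ → List A → Set
  UAt u a i z = Σ (List A) λ P → RatPow u a P ×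
    (Suffix z P × Prefix (rep i u) z) ×
    (∀ z' → Suffix z' P → Prefix (rep i u) z' → length z ≤ length z')

-- A suffix of a rational power of u has period |u|, so z = u(i) has period |u| and, as i ≥ 2,
-- begins with uu. If also z = v(j), then |z| ≥ |u| + |v|, and a word of period |u| beginning with u
-- and with v also begins with uv (what follows the first u is again a prefix of z). Likewise z begins
-- with vu, so uv = vu; u and v are then powers of a common word, and being primitive they are equal.
module Submission where

open import Defs
open import Data.Nat using (ℕ; zero; suc; _+_; _*_; _≤_; s≤s; z≤n)
open import Data.Nat.Properties
  using (≤-refl; ≤-trans; ≤-reflexive; ≤-total; +-comm; +-monoˡ-≤; +-monoʳ-≤; +-cancelˡ-≤;
         m∸n≤m; suc-injective)
open import Data.List using (List; []; _∷_; _++_; length; take; drop)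
open import Data.List.Properties
  using (∷-injective; length-++; length-++-≤ˡ; length-++-≤ʳ; length-++-comm; ++-assoc; ++-identityʳ;
         ++-cancelˡ; take++drop≡id; drop-drop; drop-[]; length-drop)
open import Data.Empty using (⊥; ⊥-elim)
open import Data.Product using (Σ; _×_; _,_)
open import Data.Sum using (inj₁; inj₂)
open import Relation.Binary.PropositionalEquality
  using (_≡_; _≢_; refl; sym; trans; cong; subst; subst₂; module ≡-Reasoning)

+-≤-of-doubles : ∀ m n {k} → m + m ≤ k → n + n ≤ k → m + n ≤ k
+-≤-of-doubles m n mm nn with ≤-total m n
... | inj₁ m≤n = ≤-trans (+-monoˡ-≤ n m≤n) nn
... | inj₂ n≤m = ≤-trans (+-monoʳ-≤ m n≤m) mm

module _ {A : Set} where

  open ≡-Reasoning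

  drop-length-++ : (xs ys : List A) → drop (length xs) (xs ++ ys) ≡ ys
  drop-length-++ []       ys = refl
  drop-length-++ (x ∷ xs) ys = drop-length-++ xs ys

  rep-+ : ∀ m n (u : List A) → rep (m + n) u ≡ rep m u ++ rep n u
  rep-+ zero    n u = refl
  rep-+ (suc m) n u = trans (cong (u ++_) (rep-+ m n u)) (sym (++-assoc u (rep m u) (rep n u)))

  rep-suc : ∀ n (u : List A) → rep (suc n) u ≡ rep n u ++ u
  rep-suc n u = begin
    rep (suc n) u        ≡⟨ cong (λ k → rep k u) (+-comm 1 n) ⟩
    rep (n + 1) u        ≡⟨ rep-+ n 1 u ⟩
    rep n u ++ (u ++ []) ≡⟨ cong (rep n u ++_) (++-identityʳ u) ⟩
    rep n u ++ u         ∎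

  prefix-trans : ∀ {x y z : List A} → Prefix x y → Prefix y z → Prefix x z
  prefix-trans {x} (s , refl) (t , refl) = s ++ t , ++-assoc x s t

  prefix-++ : ∀ (x : List A) {y z} → Prefix y z → Prefix (x ++ y) (x ++ z)
  prefix-++ x {y} (s , refl) = s , sym (++-assoc x y s)

  prefix-length : ∀ {x y : List A} → Prefix x y → length x ≤ length y
  prefix-length {x} (s , refl) = length-++-≤ˡ x

  prefix-square-length : ∀ (x : List A) {z} → Prefix (x ++ x) z → length x + length x ≤ length z
  prefix-square-length x xx = subst (_≤ _) (length-++ x) (prefix-length xx)

  prefix-length-≡ : ∀ {x y : List A} → Prefix x y → length x ≡ length y → x ≡ y
  prefix-length-≡ {[]}    ([] , refl)    _ = refl
  prefix-length-≡ {[]}    (_ ∷ _ , refl) ()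
  prefix-length-≡ {a ∷ x} (s , refl)     e = cong (a ∷_) (prefix-length-≡ (s , refl) (suc-injective e))

  prefix-≤-prefix : ∀ {x y z : List A} → Prefix x z → Prefix y z → length x ≤ length y → Prefix x y
  prefix-≤-prefix {[]}    {y}     _          _       _         = y , refl
  prefix-≤-prefix {a ∷ x} {b ∷ y} (s , refl) (t , e) (s≤s x≤y) with ∷-injective e
  ... | refl , e′ with prefix-≤-prefix (s , refl) (t , e′) x≤y
  ...   | r , refl = r , refl

  -- z[k] = z[k + p] whenever both sides are defined.
  HasPeriod : ℕ → List A → Set
  HasPeriod p z = Prefix (drop p z) z

  prefix-drop : ∀ n {x y : List A} → Prefix x y → Prefix (drop n x) (drop n y)
  prefix-drop zero    xy         = xy
  prefix-drop (suc n) {[]} {y} _ = drop (suc n) y , refl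
  prefix-drop (suc n) {a ∷ x} (s , refl) = prefix-drop n (s , refl)

  period-prefix : ∀ {p} {y z : List A} → HasPeriod p z → Prefix y z → HasPeriod p y
  period-prefix {p} {y} per yz =
    prefix-≤-prefix (prefix-trans (prefix-drop p yz) per) yz
      (≤-trans (≤-reflexive (length-drop p y)) (m∸n≤m (length y) p))

  period-suffix : ∀ {p} (x : List A) {z} → HasPeriod p (x ++ z) → HasPeriod p z
  period-suffix {p} x {z} per = subst₂ Prefix shift (drop-length-++ x z) (prefix-drop (length x) per)
    where
    shift : drop (length x) (drop p (x ++ z)) ≡ drop p z
    shift = begin
      drop (length x) (drop p (x ++ z)) ≡⟨ drop-drop p (length x) (x ++ z) ⟩
      drop (p + length x) (x ++ z)      ≡⟨ cong (λ n → drop n (x ++ z)) (+-comm p (length x)) ⟩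
      drop (length x + p) (x ++ z)      ≡⟨ drop-drop (length x) p (x ++ z) ⟨
      drop p (drop (length x) (x ++ z)) ≡⟨ cong (drop p) (drop-length-++ x z) ⟩
      drop p z                          ∎

  rep-period : ∀ n (u : List A) → HasPeriod (length u) (rep n u)
  rep-period zero    u = [] , cong (_++ []) (sym (drop-[] (length u)))
  rep-period (suc n) u = u , (begin
    rep (suc n) u                           ≡⟨ rep-suc n u ⟩
    rep n u ++ u                            ≡⟨ cong (_++ u) (drop-length-++ u (rep n u)) ⟨
    drop (length u) (rep (suc n) u) ++ u    ∎)

  ratPow-period : ∀ {u : List A} {a P} → RatPow u a P → HasPeriod (length u) P
  ratPow-period {u} (c , d , _ , _ , refl) =
    period-prefix {length u} (rep-period (suc c) u)
      (subst (Prefix (rep c u ++ take d u)) (sym (rep-suc c u))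
        (prefix-++ (rep c u) (drop d u , sym (take++drop≡id d u))))

  uAt-period : ∀ {u : List A} {a i z} → UAt u a i z → HasPeriod (length u) z
  uAt-period {u} (_ , pow , ((p , refl) , _) , _) = period-suffix {length u} p (ratPow-period pow)

  uAt-square-prefix : ∀ {u : List A} {a i z} → 2 ≤ i → UAt u a i z → Prefix (u ++ u) z
  uAt-square-prefix {u} (s≤s (s≤s {n = i} _)) (_ , _ , (_ , (s , refl)) , _) = rep i u ++ s , (begin
    (u ++ (u ++ rep i u)) ++ s   ≡⟨ ++-assoc u (u ++ rep i u) s ⟩
    u ++ ((u ++ rep i u) ++ s)   ≡⟨ cong (u ++_) (++-assoc u (rep i u) s) ⟩
    u ++ (u ++ (rep i u ++ s))   ≡⟨ ++-assoc u u (rep i u ++ s) ⟨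
    (u ++ u) ++ (rep i u ++ s)   ∎)

  period-prefix-++ : ∀ {u v z : List A} → HasPeriod (length u) z → Prefix u z → Prefix v z →
                     length u + length v ≤ length z → Prefix (u ++ v) z
  period-prefix-++ {u} {v} per (y , refl) vz bound =
    prefix-++ u (prefix-≤-prefix vz (subst (λ d → Prefix d (u ++ y)) (drop-length-++ u y) per)
                   (+-cancelˡ-≤ (length u) _ _ (subst (length u + length v ≤_) (length-++ u) bound)))

  periods-commute : ∀ {u v z : List A} → HasPeriod (length u) z → HasPeriod (length v) z →
                    Prefix u z → Prefix v z → length u + length v ≤ length z → u ++ v ≡ v ++ u
  periods-commute {u} {v} {z} per-u per-v uz vz bound =
    prefix-length-≡ (prefix-≤-prefix uv vu (≤-reflexive (length-++-comm u v))) (length-++-comm u v)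
    where
    uv = period-prefix-++ per-u uz vz bound
    vu = period-prefix-++ per-v vz uz (subst (_≤ length z) (+-comm (length u) (length v)) bound)

  CommonRoot : List A → List A → Set
  CommonRoot u v = Σ (List A) λ t → Σ ℕ λ k → Σ ℕ λ l → u ≡ rep k t × v ≡ rep l t

  commonRoot-swap : ∀ {u v : List A} → CommonRoot u v → CommonRoot v u
  commonRoot-swap (t , k , l , ut , vt) = t , l , k , vt , ut

  commonRoot-++ : ∀ {u m : List A} → CommonRoot u m → CommonRoot u (u ++ m)
  commonRoot-++ (t , k , l , refl , refl) = t , k , k + l , refl , sym (rep-+ k l t)

  private
    commute⇒commonRoot-shorter : ∀ n (u v : List A) → length (u ++ v) ≤ n →
                           u ++ v ≡ v ++ u → length u ≤ length v → CommonRoot u v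
    commute⇒commonRoot-fuel : ∀ n (u v : List A) → length (u ++ v) ≤ n →
                           u ++ v ≡ v ++ u → CommonRoot u v

    commute⇒commonRoot-fuel n u v bound eq with ≤-total (length u) (length v)
    ... | inj₁ u≤v = commute⇒commonRoot-shorter n u v bound eq u≤v
    ... | inj₂ v≤u = commonRoot-swap (commute⇒commonRoot-shorter n v u
                       (subst (_≤ n) (length-++-comm u v) bound) (sym eq) v≤u)

    commute⇒commonRoot-shorter _       []          v _ _ _ = v , 0 , 1 , refl , sym (++-identityʳ v)
    commute⇒commonRoot-shorter zero    (_ ∷ _)     _ () _ _
    commute⇒commonRoot-shorter (suc n) u@(_ ∷ u′) v (s≤s bound) eq u≤v
      with prefix-≤-prefix (v , refl) (u , eq) u≤v
    ... | m , refl = commonRoot-++ (commute⇒commonRoot-fuel n u m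
                       (≤-trans (length-++-≤ʳ (u ++ m) {u′}) bound)
                       (++-cancelˡ u _ _ (trans eq (++-assoc u m u))))

  commute⇒commonRoot : ∀ {u v : List A} → u ++ v ≡ v ++ u → CommonRoot u v
  commute⇒commonRoot {u} {v} = commute⇒commonRoot-fuel _ u v ≤-refl

  primitive-root : ∀ {u t : List A} k → Primitive u → u ≡ rep k t → u ≡ t
  primitive-root zero (u≢[] , _) refl = ⊥-elim (u≢[] refl)
  primitive-root {t = t} (suc k) (_ , prim) refl with prim t (suc k) (s≤s z≤n) refl
  ... | refl = ++-identityʳ t

  primitive-commute⇒≡ : ∀ {u v : List A} → Primitive u → Primitive v → u ++ v ≡ v ++ u → u ≡ v
  primitive-commute⇒≡ prim-u prim-v eq with commute⇒commonRoot eq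
  ... | t , k , l , ut , vt = trans (primitive-root k prim-u ut) (sym (primitive-root l prim-v vt))

lemma3p2 : {A : Set} (w u v : List A) →
    Factor u w → Factor v w → Primitive u → Primitive v → u ≢ v →
    (a b : ℕ) → MaxExp w u a → MaxExp w v b →
    3 * length u ≤ a → 3 * length v ≤ b →
    (i j : ℕ) → 2 ≤ i → (i + 1) * length u ≤ a →
    2 ≤ j → (j + 1) * length v ≤ b →
    (z : List A) → UAt u a i z → UAt v b j z → ⊥
lemma3p2 w u v _ _ prim-u prim-v u≢v a b _ _ _ _ i j 2≤i _ 2≤j _ z zu zv =
  u≢v (primitive-commute⇒≡ prim-u prim-v uv≡vu)
  where
  uu : Prefix (u ++ u) z
  uu = uAt-square-prefix {a = a} 2≤i zu

  vv : Prefix (v ++ v) z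
  vv = uAt-square-prefix {a = b} 2≤j zv

  uv≡vu : u ++ v ≡ v ++ u
  uv≡vu = periods-commute (uAt-period {a = a} {i} zu) (uAt-period {a = b} {j} zv)
            (prefix-trans (u , refl) uu) (prefix-trans (v , refl) vv)
            (+-≤-of-doubles (length u) (length v) (prefix-square-length u uu) (prefix-square-length v vv))
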